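{- Let $D$ be a digraph on vertex set $\{1,\dots,n\}$ and $q\ge 3$. There exists $f\in F[D,q]$ which is a permutation of $[q]^n$ if and only if all the vertices of $D$ can be covered by pairwise vertex-disjoint cycles.
   Context: A digraph $D=(V,E)$ has $V=\{1,\dots,n\}$, $E\subseteq V^2$ (loops allowed; a loop is a cycle of length one). Let $[q]=\{0,\dots,q-1\}$. For $f=(f_1,\dots,f_n):[q]^n\to[q]^n$, the interaction graph $\mathrm{IG}(f)$ is the digraph on $V$ with $(u,v)$ an arc iff $f_v$ depends essentially on $x_u$ (there exist $x,y$ differing only in coordinate $u$ with $f_v(x)\ne f_v(y)$). $F[D,q]=\{f:[q]^n\to[q]^n:\mathrm{IG}(f)=D\}$. -}

module Defs where

open import Data.Nat using (ℕ)
open import Data.Bool using (Bool; true)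
open import Data.Fin using (Fin)
open import Data.Vec using (Vec; lookup)
open import Data.List using (List; []; _∷_; _++_; [_])
open import Data.List.Membership.Propositional using (_∈_)
open import Data.List.Relation.Unary.Unique.Propositional using (Unique)
open import Data.List.Relation.Unary.AllPairs using (AllPairs)
open import Data.List.Relation.Unary.Any using (Any)
open import Data.Product using (Σ; ∃; _×_)
open import Data.Unit using (⊤)
open import Data.Empty using (⊥)
open import Relation.Nullary using (¬_)
open import Relation.Binary.PropositionalEquality using (_≡_; _≢_)
open import Function.Definitions using (Bijective)
open import Function.Bundles using (_⇔_)

-- A digraph on vertex set V = Fin n (standing for {1,…,n}); loops allowed.
-- (u , v) is an arc iff D u v ≡ true.
Digraph : ℕ → Set
Digraph n = Fin n → Fin n → Bool

Arc : ∀ {n} → Digraph n → Fin n → Fin n → Set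
Arc D u v = D u v ≡ true

Config : ℕ → ℕ → Set
Config n q = Vec (Fin q) n

DependsOn : ∀ {n q} → (Config n q → Config n q) → Fin n → Fin n → Set
DependsOn {n} {q} f u v =
  Σ (Config n q) λ x → Σ (Config n q) λ y →
    (∀ w → w ≢ u → lookup x w ≡ lookup y w) ×
    lookup (f x) v ≢ lookup (f y) v

HasInteractionGraph : ∀ {n q} → (Config n q → Config n q) → Digraph n → Set
HasInteractionGraph f D = ∀ u v → Arc D u v ⇔ DependsOn f u v

InF : ∀ {n} (D : Digraph n) (q : ℕ) → (Config n q → Config n q) → Set
InF D q f = HasInteractionGraph f D

Walk : ∀ {n} → Digraph n → List (Fin n) → Set
Walk D []           = ⊤
Walk D (a ∷ [])     = ⊤
Walk D (a ∷ b ∷ l)  = Arc D a b × Walk D (b ∷ l)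

-- A cycle given by its (nonempty, pairwise distinct) vertex list
-- v₀ v₁ … v_{k-1}, with arcs v₀→v₁→…→v_{k-1}→v₀.  k = 1 is a loop.
IsCycle : ∀ {n} → Digraph n → List (Fin n) → Set
IsCycle D []       = ⊥
IsCycle D (v ∷ vs) = Unique (v ∷ vs) × Walk D ((v ∷ vs) ++ [ v ])

Disjoint : ∀ {n} → List (Fin n) → List (Fin n) → Set
Disjoint xs ys = ∀ {v} → v ∈ xs → ¬ (v ∈ ys)

CoverableByDisjointCycles : ∀ {n} → Digraph n → Set
CoverableByDisjointCycles {n} D =
  Σ (List (List (Fin n))) λ cs →
    Data.List.Relation.Unary.All.All (IsCycle D) cs ×
    AllPairs Disjoint cs ×
    (∀ (v : Fin n) → Any (v ∈_) cs)
  where import Data.List.Relation.Unary.All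

IsPermutation : ∀ {n q} → (Config n q → Config n q) → Set
IsPermutation f = Bijective _≡_ _≡_ f

-- A bijection f with interaction graph D forces every set T of vertices to have at least |T|
-- in-neighbours: the coordinates of f(x) in T depend only on the coordinates of x in the
-- in-neighbourhood N(T), so sending x ∈ [q]^T to f⁻¹(x) restricted to N(T) is an injection
-- [q]^T → [q]^N(T), whence q^|T| ≤ q^|N(T)|.
-- By Hall's theorem, distinct vertices can then be assigned distinct in-neighbours σ(v), and the
-- orbits of the permutation σ are disjoint cycles of D covering every vertex.  Conversely, a cycle
-- cover yields such a σ, and for q ≥ 3 the map whose v-th coordinate is x_{σ(v)}, with 0 and 1
-- exchanged exactly when every other in-neighbour u of v has x_u ≥ 2, is a bijection whose
-- interaction graph is D: it moves the pattern of coordinates ≥ 2 along σ, so it can be inverted.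
module Submission where

open import Defs
open import Data.Nat using (ℕ; zero; suc; _+_; _∸_; _^_; _≤_; _<_; _≥_; z≤n; s≤s; _≤?_; _<?_)
open import Data.Nat.Properties
  using ( +-suc; +-mono-≤; +-cancelˡ-≤; ≤-refl; ≤-reflexive; ≤-trans; ≤-antisym; ≤-pred; ≤-<-trans
        ; n≤1+n; n<1+n; m≤n⇒m≤1+n; m≤n⇒m<n∨m≡n; m∸n+n≡m; <⇒≱; >⇒≢; ≮⇒≥; ≰⇒>; ^-monoʳ-<
        ; module ≤-Reasoning)
open import Data.Bool using (Bool; true; false)
open import Data.Bool.Properties using () renaming (_≟_ to _≟ᵇ_)
open import Data.Fin using (Fin; zero; suc; toℕ; fromℕ; fromℕ<; inject; punchOut; combine; remQuot)
open import Data.Fin.Properties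
  using ( any?; all?; punchOut-injective; injective⇒≤; pigeonhole; ¬∀⟶∃¬-smallest; toℕ-injective; toℕ-fromℕ
        ; toℕ-fromℕ<; toℕ-inject; combine-remQuot; combine-injective)
  renaming (_≟_ to _≟ᶠ_)
open import Data.Vec using (Vec; []; _∷_; lookup; tabulate; replicate; _[_]≔_; here; there)
open import Data.Vec.Properties
  using ( lookup∘tabulate; tabulate∘lookup; tabulate-cong; lookup∘update; lookup∘update′; lookup-replicate
        ; lookup⇒[]=; []=⇒lookup)
open import Data.Product using (Σ; ∃-syntax; _×_; _,_; proj₁; proj₂)
open import Data.Sum using (inj₁; inj₂)
open import Data.Empty using (⊥-elim)
open import Function using (_∘_)
open import Function.Bundles using (_⇔_; mk⇔; Equivalence)
open import Function.Definitions using (Injective)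
open import Function.Consequences.Propositional
  using (inverseᵇ⇒bijective; strictlyInverseˡ⇒inverseˡ; strictlyInverseʳ⇒inverseʳ)
open import Relation.Nullary using (¬_; Dec; yes; no; does; ¬?; _×-dec_; _→-dec_; contradiction)
open import Relation.Nullary.Decidable using (decidable-stable; does-⇔; dec-true; dec-false)
open import Relation.Unary using (Decidable)
open import Relation.Binary using (DecidableEquality)
open import Relation.Binary.PropositionalEquality hiding ([_])
open import Data.Fin.Subset
  using (Subset; inside; outside; _∈_; _∉_; _⊆_; _∩_; _∪_; _─_; _-_; ⁅_⁆; ∣_∣; ⊤; Nonempty; Empty)
open import Data.Fin.Subset.Properties
  using ( _∈?_; _⊆?_; nonempty?; anySubset?; Empty-unique; ∈⊤; x∈⁅x⁆; x∈⁅y⁆⇒x≡y; ⊆-trans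
        ; x∈p∩q⁺; x∈p∩q⁻; p∩q⊆q; ∩-identityʳ; x∈p∪q⁻; p⊆p∪q; q⊆p∪q; x∈p∧x∉q⇒x∈p─q; p─q⊆p
        ; ∣⊥∣≡0; ∣⁅x⁆∣≡1; p⊆q⇒∣p∣≤∣q∣; ∣p∩q∣≤∣q∣; p∩q≢∅⇒∣p─q∣<∣p∣; x∈p⇒∣p-x∣<∣p∣)
open import Data.Nat.Induction using (<-wellFounded)
open import Induction.WellFounded using (Acc; acc)

does⇒witness : ∀ {A : Set} (a? : Dec A) → does a? ≡ true → A
does⇒witness (yes a) _ = a

leastWitness : ∀ {P : ℕ → Set} → Decidable P → ∀ {K} → P K →
               ∃[ k ] P k × (∀ {j} → j < k → ¬ P j)
leastWitness {P} P? {K} pK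
  with i , ¬¬Pi , smaller ← ¬∀⟶∃¬-smallest (suc K) (¬_ ∘ P ∘ toℕ) (¬? ∘ P? ∘ toℕ)
                              (λ ¬P → ¬P (fromℕ K) (subst P (sym (toℕ-fromℕ K)) pK))
  = toℕ i , decidable-stable (P? (toℕ i)) ¬¬Pi ,
    λ j<i → subst (¬_ ∘ P) (trans (toℕ-inject _) (toℕ-fromℕ< j<i)) (smaller (fromℕ< j<i))

injective⇒surjective : ∀ {n} {f : Fin n → Fin n} → Injective _≡_ _≡_ f → ∀ y → ∃[ x ] f x ≡ y
injective⇒surjective {suc n} {f} f-inj y with any? (λ x → f x ≟ᶠ y)
... | yes f⁻¹y = f⁻¹y
... | no  ∄x = contradiction (injective⇒≤ g-inj) (<⇒≱ ≤-refl)
  where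
  -- Missing y, f would inject Fin (suc n) into Fin n.
  y≢f : ∀ x → y ≢ f x
  y≢f x y≡fx = ∄x (x , sym y≡fx)
  g : Fin (suc n) → Fin n
  g x = punchOut (y≢f x)
  g-inj : Injective _≡_ _≡_ g
  g-inj {x} {x′} eq = f-inj (punchOut-injective (y≢f x) (y≢f x′) eq)

module InverseOfInjective {n} {f : Fin n → Fin n} (f-injective : Injective _≡_ _≡_ f) where

  f⁻¹ : Fin n → Fin n
  f⁻¹ y = proj₁ (injective⇒surjective f-injective y)

  f∘f⁻¹ : ∀ y → f (f⁻¹ y) ≡ y
  f∘f⁻¹ y = proj₂ (injective⇒surjective f-injective y)

  f⁻¹∘f : ∀ x → f⁻¹ (f x) ≡ x
  f⁻¹∘f x = f-injective (f∘f⁻¹ (f x))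

  f⁻¹-injective : Injective _≡_ _≡_ f⁻¹
  f⁻¹-injective {y} {y′} eq = trans (sym (f∘f⁻¹ y)) (trans (cong f eq) (f∘f⁻¹ y′))

∣p∣≡∣p∩q∣+∣p─q∣ : ∀ {n} (p q : Subset n) → ∣ p ∣ ≡ ∣ p ∩ q ∣ + ∣ p ─ q ∣
∣p∣≡∣p∩q∣+∣p─q∣ []            []            = refl
∣p∣≡∣p∩q∣+∣p─q∣ (inside  ∷ p) (inside  ∷ q) = cong suc (∣p∣≡∣p∩q∣+∣p─q∣ p q)
∣p∣≡∣p∩q∣+∣p─q∣ (inside  ∷ p) (outside ∷ q) =
  trans (cong suc (∣p∣≡∣p∩q∣+∣p─q∣ p q)) (sym (+-suc ∣ p ∩ q ∣ ∣ p ─ q ∣))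
∣p∣≡∣p∩q∣+∣p─q∣ (outside ∷ p) (inside  ∷ q) = ∣p∣≡∣p∩q∣+∣p─q∣ p q
∣p∣≡∣p∩q∣+∣p─q∣ (outside ∷ p) (outside ∷ q) = ∣p∣≡∣p∩q∣+∣p─q∣ p q

x∈p─q⇒x∉q : ∀ {n} {x : Fin n} {p q : Subset n} → x ∈ p ─ q → x ∉ q
x∈p─q⇒x∉q {p = _ ∷ _} {inside  ∷ _} (there x∈p─q) (there x∈q) = x∈p─q⇒x∉q x∈p─q x∈q
x∈p─q⇒x∉q {p = _ ∷ _} {outside ∷ _} (there x∈p─q) (there x∈q) = x∈p─q⇒x∉q x∈p─q x∈q
x∈p─q⇒x∉q {p = inside ∷ _} {outside ∷ _} here ()

Empty⇒∣p∣≡0 : ∀ {n} {p : Subset n} → Empty p → ∣ p ∣ ≡ 0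
Empty⇒∣p∣≡0 {n} p=∅ rewrite Empty-unique p=∅ = ∣⊥∣≡0 n

∣p∣>0⇒Nonempty : ∀ {n} {p : Subset n} → 0 < ∣ p ∣ → Nonempty p
∣p∣>0⇒Nonempty {p = p} ∣p∣>0 with nonempty? p
... | yes p≠∅ = p≠∅
... | no  p=∅ = contradiction (Empty⇒∣p∣≡0 p=∅) (>⇒≢ ∣p∣>0)

∣p∣+∣q∣≤∣p∪q∣ : ∀ {n} {p q : Subset n} → (∀ {x} → x ∈ p → x ∉ q) → ∣ p ∣ + ∣ q ∣ ≤ ∣ p ∪ q ∣
∣p∣+∣q∣≤∣p∪q∣ {p = p} {q} p∩q=∅ = begin
  ∣ p ∣ + ∣ q ∣                         ≤⟨ +-mono-≤ (p⊆q⇒∣p∣≤∣q∣ p⊆) (p⊆q⇒∣p∣≤∣q∣ q⊆) ⟩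
  ∣ (p ∪ q) ∩ p ∣ + ∣ (p ∪ q) ─ p ∣     ≡⟨ ∣p∣≡∣p∩q∣+∣p─q∣ (p ∪ q) p ⟨
  ∣ p ∪ q ∣                             ∎
  where
  open ≤-Reasoning
  p⊆ : p ⊆ (p ∪ q) ∩ p
  p⊆ x∈p = x∈p∩q⁺ (p⊆p∪q q x∈p , x∈p)
  q⊆ : q ⊆ (p ∪ q) ─ p
  q⊆ x∈q = x∈p∧x∉q⇒x∈p─q (q⊆p∪q p q x∈q) (λ x∈p → p∩q=∅ x∈p x∈q)

x∈p⇒⁅x⁆⊆p : ∀ {n} {x : Fin n} {p : Subset n} → x ∈ p → ⁅ x ⁆ ⊆ p
x∈p⇒⁅x⁆⊆p {x = x} {p} x∈p y∈⁅x⁆ = subst (_∈ p) (sym (x∈⁅y⁆⇒x≡y x y∈⁅x⁆)) x∈p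

module Hall {m n : ℕ} {Adj : Fin m → Fin n → Set} (Adj? : ∀ i j → Dec (Adj i j)) where

  neighbours : Subset m → Subset n
  neighbours T = tabulate λ j → does (any? λ i → i ∈? T ×-dec Adj? i j)

  ∈-neighbours⁺ : ∀ {T i j} → i ∈ T → Adj i j → j ∈ neighbours T
  ∈-neighbours⁺ {T} {i} {j} i∈T adj = lookup⇒[]= j _
    (trans (lookup∘tabulate _ j) (dec-true (any? _) (i , i∈T , adj)))

  ∈-neighbours⁻ : ∀ {T j} → j ∈ neighbours T → ∃[ i ] i ∈ T × Adj i j
  ∈-neighbours⁻ {T} {j} j∈N =
    does⇒witness (any? _) (trans (sym (lookup∘tabulate _ j)) ([]=⇒lookup j∈N))

  neighbours-mono : ∀ {S T} → S ⊆ T → neighbours S ⊆ neighbours T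
  neighbours-mono S⊆T j∈N with ∈-neighbours⁻ j∈N
  ... | i , i∈S , adj = ∈-neighbours⁺ (S⊆T i∈S) adj

  HallCondition : Subset m → Subset n → Set
  HallCondition L R = ∀ {T} → T ⊆ L → ∣ T ∣ ≤ ∣ neighbours T ∩ R ∣

  record Matching (L : Subset m) (R : Subset n) : Set where
    field
      match     : ∀ {i} → i ∈ L → Fin n
      match-∈   : ∀ {i} (i∈L : i ∈ L) → match i∈L ∈ R
      match-adj : ∀ {i} (i∈L : i ∈ L) → Adj i (match i∈L)
      match-inj : ∀ {i i′} (i∈L : i ∈ L) (i′∈L : i′ ∈ L) → match i∈L ≡ match i′∈L → i ≡ i′

  open Matching

  emptyMatching : ∀ {L R} → Empty L → Matching L R
  emptyMatching L=∅ = record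
    { match     = λ i∈L → ⊥-elim (L=∅ (_ , i∈L))
    ; match-∈   = λ i∈L → ⊥-elim (L=∅ (_ , i∈L))
    ; match-adj = λ i∈L → ⊥-elim (L=∅ (_ , i∈L))
    ; match-inj = λ i∈L _ _ → ⊥-elim (L=∅ (_ , i∈L))
    }

  singletonMatching : ∀ {i j} → Adj i j → Matching ⁅ i ⁆ ⁅ j ⁆
  singletonMatching {i} {j} adj = record
    { match     = λ _ → j
    ; match-∈   = λ _ → x∈⁅x⁆ j
    ; match-adj = λ i′∈⁅i⁆ → subst (λ i′ → Adj i′ j) (sym (x∈⁅y⁆⇒x≡y i i′∈⁅i⁆)) adj
    ; match-inj = λ i′∈⁅i⁆ i″∈⁅i⁆ _ → trans (x∈⁅y⁆⇒x≡y i i′∈⁅i⁆) (sym (x∈⁅y⁆⇒x≡y i i″∈⁅i⁆))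
    }

  glue : ∀ {L R} T {R₁ R₂} → R₁ ⊆ R → R₂ ⊆ R → (∀ {j} → j ∈ R₁ → j ∉ R₂) →
         Matching T R₁ → Matching (L ─ T) R₂ → Matching L R
  glue {L} {R} T R₁⊆R R₂⊆R R₁∩R₂=∅ M₁ M₂ = record
    { match = σ ; match-∈ = σ-∈ ; match-adj = σ-adj ; match-inj = σ-inj }
    where
    σ : ∀ {i} → i ∈ L → Fin n
    σ {i} i∈L with i ∈? T
    ... | yes i∈T = match M₁ i∈T
    ... | no  i∉T = match M₂ (x∈p∧x∉q⇒x∈p─q i∈L i∉T)

    σ-∈ : ∀ {i} (i∈L : i ∈ L) → σ i∈L ∈ R
    σ-∈ {i} i∈L with i ∈? T
    ... | yes i∈T = R₁⊆R (match-∈ M₁ i∈T)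
    ... | no  i∉T = R₂⊆R (match-∈ M₂ _)

    σ-adj : ∀ {i} (i∈L : i ∈ L) → Adj i (σ i∈L)
    σ-adj {i} i∈L with i ∈? T
    ... | yes i∈T = match-adj M₁ i∈T
    ... | no  i∉T = match-adj M₂ _

    σ-inj : ∀ {i i′} (i∈L : i ∈ L) (i′∈L : i′ ∈ L) → σ i∈L ≡ σ i′∈L → i ≡ i′
    σ-inj {i} {i′} i∈L i′∈L eq with i ∈? T | i′ ∈? T
    ... | yes i∈T | yes i′∈T = match-inj M₁ i∈T i′∈T eq
    ... | no  _   | no  _    = match-inj M₂ _ _ eq
    ... | yes i∈T | no  _    = ⊥-elim (R₁∩R₂=∅ (match-∈ M₁ i∈T) (subst (_∈ _) (sym eq) (match-∈ M₂ _)))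
    ... | no  _   | yes i′∈T = ⊥-elim (R₁∩R₂=∅ (match-∈ M₁ i′∈T) (subst (_∈ _) eq (match-∈ M₂ _)))

  Critical : Subset m → Subset n → Subset m → Set
  Critical L R T = T ⊆ L × Nonempty T × ∣ T ∣ < ∣ L ∣ × ∣ neighbours T ∩ R ∣ ≤ ∣ T ∣

  critical? : ∀ L R T → Dec (Critical L R T)
  critical? L R T =
    T ⊆? L ×-dec nonempty? T ×-dec ∣ T ∣ <? ∣ L ∣ ×-dec ∣ neighbours T ∩ R ∣ ≤? ∣ T ∣

  hallCondition⇒neighbour : ∀ {L R i} → HallCondition L R → i ∈ L → ∃[ j ] j ∈ R × Adj i j
  hallCondition⇒neighbour {L} {R} {i} hc i∈L
    with j , j∈ ← ∣p∣>0⇒Nonempty (subst (_≤ ∣ neighbours ⁅ i ⁆ ∩ R ∣) (∣⁅x⁆∣≡1 i) (hc (x∈p⇒⁅x⁆⊆p i∈L)))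
    with j∈N , j∈R ← x∈p∩q⁻ _ _ j∈
    with i′ , i′∈⁅i⁆ , adj ← ∈-neighbours⁻ j∈N
    = j , j∈R , subst (λ i′ → Adj i′ j) (x∈⁅y⁆⇒x≡y i i′∈⁅i⁆) adj

  hallCondition-critical : ∀ {L R T} → HallCondition L R → T ⊆ L →
                           HallCondition T (neighbours T ∩ R)
  hallCondition-critical {R = R} {T} hc T⊆L {S} S⊆T =
    ≤-trans (hc (⊆-trans S⊆T T⊆L)) (p⊆q⇒∣p∣≤∣q∣ N⊆)
    where
    N⊆ : neighbours S ∩ R ⊆ neighbours S ∩ (neighbours T ∩ R)
    N⊆ j∈ with j∈N , j∈R ← x∈p∩q⁻ _ _ j∈ =
      x∈p∩q⁺ (j∈N , x∈p∩q⁺ (neighbours-mono S⊆T j∈N , j∈R))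

  hallCondition-remainder : ∀ {L R T} → HallCondition L R → T ⊆ L → ∣ neighbours T ∩ R ∣ ≤ ∣ T ∣ →
                            HallCondition (L ─ T) (R ─ neighbours T)
  hallCondition-remainder {L} {R} {T} hc T⊆L tight {S} S⊆L─T = +-cancelˡ-≤ ∣ T ∣ _ _ (begin
    ∣ T ∣ + ∣ S ∣                                    ≤⟨ ∣p∣+∣q∣≤∣p∪q∣ T∩S=∅ ⟩
    ∣ T ∪ S ∣                                        ≤⟨ hc T∪S⊆L ⟩
    ∣ X ∣                                            ≡⟨ ∣p∣≡∣p∩q∣+∣p─q∣ X (neighbours T) ⟩
    ∣ X ∩ neighbours T ∣ + ∣ X ─ neighbours T ∣
      ≤⟨ +-mono-≤ (≤-trans (p⊆q⇒∣p∣≤∣q∣ X∩NT⊆) tight) (p⊆q⇒∣p∣≤∣q∣ X─NT⊆) ⟩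
    ∣ T ∣ + ∣ neighbours S ∩ (R ─ neighbours T) ∣    ∎)
    where
    open ≤-Reasoning
    X = neighbours (T ∪ S) ∩ R
    T∩S=∅ : ∀ {i} → i ∈ T → i ∉ S
    T∩S=∅ i∈T i∈S = x∈p─q⇒x∉q (S⊆L─T i∈S) i∈T
    T∪S⊆L : T ∪ S ⊆ L
    T∪S⊆L i∈ with x∈p∪q⁻ T S i∈
    ... | inj₁ i∈T = T⊆L i∈T
    ... | inj₂ i∈S = p─q⊆p L T (S⊆L─T i∈S)
    X∩NT⊆ : X ∩ neighbours T ⊆ neighbours T ∩ R
    X∩NT⊆ j∈ with j∈X , j∈NT ← x∈p∩q⁻ _ _ j∈ = x∈p∩q⁺ (j∈NT , p∩q⊆q _ _ j∈X)
    X─NT⊆ : X ─ neighbours T ⊆ neighbours S ∩ (R ─ neighbours T)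
    X─NT⊆ j∈ with j∈N , j∈R ← x∈p∩q⁻ _ _ (p─q⊆p X _ j∈)
             with i , i∈T∪S , adj ← ∈-neighbours⁻ j∈N
             with x∈p∪q⁻ T S i∈T∪S
    ... | inj₁ i∈T = contradiction (∈-neighbours⁺ i∈T adj) (x∈p─q⇒x∉q j∈)
    ... | inj₂ i∈S = x∈p∩q⁺ (∈-neighbours⁺ i∈S adj , x∈p∧x∉q⇒x∈p─q j∈R (x∈p─q⇒x∉q j∈))

  hallCondition-noCritical : ∀ {L R i₀} j₀ → HallCondition L R → (∀ T → ¬ Critical L R T) → i₀ ∈ L →
                             HallCondition (L - i₀) (R - j₀)
  hallCondition-noCritical {L} {R} {i₀} j₀ hc noCritical i₀∈L {S} S⊆L-i₀ with nonempty? S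
  ... | no  S=∅ = ≤-trans (≤-reflexive (Empty⇒∣p∣≡0 S=∅)) z≤n
  ... | yes S≠∅ = ≤-pred (begin-strict
    ∣ S ∣                                   <⟨ expands ⟩
    ∣ X ∣                                   ≡⟨ ∣p∣≡∣p∩q∣+∣p─q∣ X ⁅ j₀ ⁆ ⟩
    ∣ X ∩ ⁅ j₀ ⁆ ∣ + ∣ X - j₀ ∣
      ≤⟨ +-mono-≤ (≤-trans (∣p∩q∣≤∣q∣ X ⁅ j₀ ⁆) (≤-reflexive (∣⁅x⁆∣≡1 j₀))) (p⊆q⇒∣p∣≤∣q∣ X-j₀⊆) ⟩
    1 + ∣ neighbours S ∩ (R - j₀) ∣          ∎)
    where
    open ≤-Reasoning
    X = neighbours S ∩ R
    S⊆L : S ⊆ L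
    S⊆L = ⊆-trans S⊆L-i₀ (p─q⊆p L ⁅ i₀ ⁆)
    ∣S∣<∣L∣ : ∣ S ∣ < ∣ L ∣
    ∣S∣<∣L∣ = ≤-<-trans (p⊆q⇒∣p∣≤∣q∣ S⊆L-i₀) (x∈p⇒∣p-x∣<∣p∣ i₀∈L)
    expands : ∣ S ∣ < ∣ X ∣
    expands with ∣ X ∣ ≤? ∣ S ∣
    ... | yes tight = contradiction ((λ {_} → S⊆L) , S≠∅ , ∣S∣<∣L∣ , tight) (noCritical S)
    ... | no  loose = ≰⇒> loose
    X-j₀⊆ : X - j₀ ⊆ neighbours S ∩ (R - j₀)
    X-j₀⊆ j∈ with j∈N , j∈R ← x∈p∩q⁻ _ _ (p─q⊆p X _ j∈) =
      x∈p∩q⁺ (j∈N , x∈p∧x∉q⇒x∈p─q j∈R (x∈p─q⇒x∉q j∈))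

  matching : ∀ L R → HallCondition L R → Acc _<_ ∣ L ∣ → Matching L R
  matching L R hc (acc rec) with anySubset? (critical? L R)
  ... | yes (T , T⊆L , (i , i∈T) , ∣T∣<∣L∣ , tight) =
    glue T (p∩q⊆q _ R) (p─q⊆p R _) (λ j∈ j∈′ → x∈p─q⇒x∉q j∈′ (proj₁ (x∈p∩q⁻ _ _ j∈)))
      (matching T (neighbours T ∩ R) (hallCondition-critical hc T⊆L) (rec ∣T∣<∣L∣))
      (matching (L ─ T) (R ─ neighbours T) (hallCondition-remainder hc T⊆L tight)
        (rec (p∩q≢∅⇒∣p─q∣<∣p∣ L T (i , x∈p∩q⁺ (T⊆L i∈T , i∈T)))))
  ... | no noCritical with nonempty? L
  ...   | no  L=∅ = emptyMatching L=∅
  ...   | yes (i₀ , i₀∈L) with j₀ , j₀∈R , adj ← hallCondition⇒neighbour hc i₀∈L =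
    glue ⁅ i₀ ⁆ (x∈p⇒⁅x⁆⊆p j₀∈R) (p─q⊆p R _) (λ j∈ j∈′ → x∈p─q⇒x∉q j∈′ j∈)
      (singletonMatching adj)
      (matching (L - i₀) (R - j₀) (hallCondition-noCritical j₀ hc (λ T → noCritical ∘ (T ,_)) i₀∈L)
        (rec (x∈p⇒∣p-x∣<∣p∣ i₀∈L)))

  hall : (∀ T → ∣ T ∣ ≤ ∣ neighbours T ∣) →
         ∃[ f ] Injective _≡_ _≡_ f × ∀ i → Adj i (f i)
  hall expands = (λ i → match M (∈⊤ {x = i})) , match-inj M ∈⊤ ∈⊤ , λ i → match-adj M ∈⊤
    where
    M : Matching ⊤ ⊤
    M = matching ⊤ ⊤ (λ {T} _ → subst (∣ T ∣ ≤_) (cong ∣_∣ (sym (∩-identityʳ (neighbours T)))) (expands T))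
                 (<-wellFounded _)

determinedBy : ∀ {A B : Set} → DecidableEquality B → ∀ {n} (g : Vec A n → B) (P : Fin n → Set) →
               (∀ w x a → g x ≢ g (x [ w ]≔ a) → P w) →
               ∀ x y → (∀ w → P w → lookup x w ≡ lookup y w) → g x ≡ g y
determinedBy _≟_ g P essential []      []      agree = refl
determinedBy _≟_ g P essential (a ∷ x) (b ∷ y) agree =
  trans g[a∷x]≡g[b∷x]
    (determinedBy _≟_ (g ∘ (b ∷_)) (P ∘ suc) (λ w → essential (suc w) ∘ (b ∷_)) x y (agree ∘ suc))
  where
  g[a∷x]≡g[b∷x] : g (a ∷ x) ≡ g (b ∷ x)
  g[a∷x]≡g[b∷x] with g (a ∷ x) ≟ g (b ∷ x)
  ... | yes eq  = eq
  ... | no  neq = cong (λ c → g (c ∷ x)) (agree zero (essential zero (a ∷ x) b neq))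

module _ {n q : ℕ} {D : Digraph n} (f : Config n q → Config n q) (f∈F : InF D q f) where

  inF⇒local : ∀ v x y → (∀ u → Arc D u v → lookup x u ≡ lookup y u) → lookup (f x) v ≡ lookup (f y) v
  inF⇒local v = determinedBy _≟ᶠ_ (λ x → lookup (f x) v) (λ u → Arc D u v) essential
    where
    essential : ∀ u x a → lookup (f x) v ≢ lookup (f (x [ u ]≔ a)) v → Arc D u v
    essential u x a neq = Equivalence.from (f∈F u v)
      (x , x [ u ]≔ a , (λ w w≢u → sym (lookup∘update′ w≢u x a)) , neq)

module Restriction (q : ℕ) where

  restrict : ∀ {n} (T : Subset n) → Vec (Fin (suc q)) n → Fin (suc q ^ ∣ T ∣)
  restrict []            []      = zero
  restrict (outside ∷ T) (_ ∷ x) = restrict T x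
  restrict (inside  ∷ T) (a ∷ x) = combine a (restrict T x)

  extend : ∀ {n} (T : Subset n) → Fin (suc q ^ ∣ T ∣) → Vec (Fin (suc q)) n
  extend []            _ = []
  extend (outside ∷ T) c = zero ∷ extend T c
  extend (inside  ∷ T) c = let a , c′ = remQuot {suc q} (suc q ^ ∣ T ∣) c in a ∷ extend T c′

  restrict-extend : ∀ {n} (T : Subset n) c → restrict T (extend T c) ≡ c
  restrict-extend []            zero = refl
  restrict-extend (outside ∷ T) c    = restrict-extend T c
  restrict-extend (inside  ∷ T) c    =
    let a , c′ = remQuot {suc q} (suc q ^ ∣ T ∣) c in
    trans (cong (combine a) (restrict-extend T c′)) (combine-remQuot {suc q} (suc q ^ ∣ T ∣) c)

  restrict-cong : ∀ {n} (T : Subset n) {x y} → (∀ {i} → i ∈ T → lookup x i ≡ lookup y i) →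
                  restrict T x ≡ restrict T y
  restrict-cong []            {[]}    {[]}    agree = refl
  restrict-cong (outside ∷ T) {_ ∷ _} {_ ∷ _} agree = restrict-cong T (agree ∘ there)
  restrict-cong (inside  ∷ T) {_ ∷ _} {_ ∷ _} agree =
    cong₂ combine (agree here) (restrict-cong T (agree ∘ there))

  restrict-injective : ∀ {n} (T : Subset n) {x y} → restrict T x ≡ restrict T y →
                       ∀ {i} → i ∈ T → lookup x i ≡ lookup y i
  restrict-injective (outside ∷ T) {_ ∷ _} {_ ∷ _} eq (there i∈T) = restrict-injective T eq i∈T
  restrict-injective (inside  ∷ T) {a ∷ _} {b ∷ _} eq here        = proj₁ (combine-injective a _ b _ eq)
  restrict-injective (inside  ∷ T) {a ∷ _} {b ∷ _} eq (there i∈T) =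
    restrict-injective T (proj₂ (combine-injective a _ b _ eq)) i∈T

-- A spanning family of disjoint cycles of D, presented as the permutation σ sending each vertex to
-- its predecessor on its cycle.
record CycleFactor {n : ℕ} (D : Digraph n) : Set where
  field
    σ           : Fin n → Fin n
    σ-injective : Injective _≡_ _≡_ σ
    σ-arc       : ∀ v → Arc D (σ v) v

module _ {n q : ℕ} {D : Digraph n} {f : Config n (suc q) → Config n (suc q)}
         (f∈F : InF D (suc q) f) (f-bijective : IsPermutation f) where

  -- Matching v to u along arcs u → v, so that neighbours T is the in-neighbourhood of T.
  open Hall (λ v u → D u v ≟ᵇ true)
  open Restriction q

  private
    f⁻¹ : Config n (suc q) → Config n (suc q)
    f⁻¹ y = proj₁ (proj₂ f-bijective y)

    f∘f⁻¹ : ∀ y → f (f⁻¹ y) ≡ y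
    f∘f⁻¹ y = proj₂ (proj₂ f-bijective y) refl

  inNeighbourhood-expands : 1 < suc q → ∀ T → ∣ T ∣ ≤ ∣ neighbours T ∣
  inNeighbourhood-expands 1<q T =
    ≮⇒≥ λ ∣N∣<∣T∣ → <⇒≱ (^-monoʳ-< (suc q) 1<q ∣N∣<∣T∣) (injective⇒≤ g-injective)
    where
    g : Fin (suc q ^ ∣ T ∣) → Fin (suc q ^ ∣ neighbours T ∣)
    g c = restrict (neighbours T) (f⁻¹ (extend T c))

    g-injective : Injective _≡_ _≡_ g
    g-injective {c} {c′} eq = begin
      c                        ≡⟨ restrict-extend T c ⟨
      restrict T (extend T c)  ≡⟨ restrict-cong T agree ⟩
      restrict T (extend T c′) ≡⟨ restrict-extend T c′ ⟩
      c′                       ∎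
      where
      open ≡-Reasoning
      agree : ∀ {v} → v ∈ T → lookup (extend T c) v ≡ lookup (extend T c′) v
      agree {v} v∈T = begin
        lookup (extend T c) v             ≡⟨ cong (λ y → lookup y v) (f∘f⁻¹ _) ⟨
        lookup (f (f⁻¹ (extend T c))) v   ≡⟨ inF⇒local f f∈F v _ _ (λ u u→v →
                                               restrict-injective (neighbours T) eq (∈-neighbours⁺ v∈T u→v)) ⟩
        lookup (f (f⁻¹ (extend T c′))) v  ≡⟨ cong (λ y → lookup y v) (f∘f⁻¹ _) ⟩
        lookup (extend T c′) v            ∎

  permutation⇒cycleFactor : 1 < suc q → CycleFactor D
  permutation⇒cycleFactor 1<q with σ , σ-injective , σ-arc ← hall (inNeighbourhood-expands 1<q) =
    record { σ = σ ; σ-injective = σ-injective ; σ-arc = σ-arc }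

module Cycles where

  open import Data.List using (List; []; _∷_; _++_; [_]; map; filter; allFin)
  open import Data.List.Membership.Propositional using () renaming (_∈_ to _∈ˡ_)
  open import Data.List.Membership.Propositional.Properties using (∈-allFin; ∈-filter⁺; ∈-++⁻)
  open import Data.List.Relation.Unary.Any as Any using (Any; here; there)
  open import Data.List.Relation.Unary.Any.Properties as Any using ()
  open import Data.List.Relation.Unary.All as All using (All; []; _∷_)
  open import Data.List.Relation.Unary.All.Properties as All using (all-filter)
  open import Data.List.Relation.Unary.AllPairs as AllPairs using (AllPairs; []; _∷_)
  open import Data.List.Relation.Unary.AllPairs.Properties as AllPairs using ()
  open import Data.List.Relation.Unary.Unique.Propositional using (Unique)
  open import Data.List.Relation.Unary.Unique.Propositional.Properties as Unique using (allFin⁺)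
  open import Data.List.Extrema.Nat using (argmin; argmin-sel; f[argmin]≤f[xs])
  open import Data.Nat.GeneralisedArithmetic using (fold; fold-+)
  open import Data.Unit using (tt)

  AllPairs-restrict : ∀ {A : Set} {P : A → Set} {R S : A → A → Set} →
                      (∀ {x y} → P x → P y → R x y → S x y) →
                      ∀ {xs} → All P xs → AllPairs R xs → AllPairs S xs
  AllPairs-restrict f []         []         = []
  AllPairs-restrict f (px ∷ pxs) (rx ∷ rxs) =
    All.zipWith (λ (py , r) → f px py r) (pxs , rx) ∷ AllPairs-restrict f pxs rxs

  module Orbits {n : ℕ} {D : Digraph n} (F : CycleFactor D) where
    open CycleFactor F

    σ^ : ℕ → Fin n → Fin n
    σ^ k v = fold v σ k

    σ^-repeat⇒periodic : ∀ {i j v} → i < j → σ^ i v ≡ σ^ j v → ∃[ k ] σ^ (suc k) v ≡ v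
    σ^-repeat⇒periodic {zero}  {suc k} _          eq = k , sym eq
    σ^-repeat⇒periodic {suc i} {suc j} (s≤s i<j) eq = σ^-repeat⇒periodic i<j (σ-injective eq)

    periodic : ∀ v → ∃[ k ] σ^ (suc k) v ≡ v
    periodic v with i , j , i<j , eq ← pigeonhole (n<1+n n) (λ i → σ^ (toℕ i) v) =
      σ^-repeat⇒periodic i<j eq

    private
      minimalPeriod : ∀ v → ∃[ k ] σ^ (suc k) v ≡ v × (∀ {j} → j < k → σ^ (suc j) v ≢ v)
      minimalPeriod v = leastWitness (λ k → σ^ (suc k) v ≟ᶠ v) {proj₁ (periodic v)} (proj₂ (periodic v))

    -- The cycle through v has period v + 1 vertices.
    period : Fin n → ℕ
    period v = proj₁ (minimalPeriod v)

    σ^-period : ∀ v → σ^ (suc (period v)) v ≡ v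
    σ^-period v = proj₁ (proj₂ (minimalPeriod v))

    σ^-distinct : ∀ {v i j} → i < j → j ≤ period v → σ^ i v ≢ σ^ j v
    σ^-distinct {v} {zero}  {suc j} _         j<p eq = proj₂ (proj₂ (minimalPeriod v)) j<p (sym eq)
    σ^-distinct {v} {suc i} {suc j} (s≤s i<j) j<p eq =
      σ^-distinct i<j (≤-trans (n≤1+n j) j<p) (σ-injective eq)

    orbitUpTo : ℕ → Fin n → List (Fin n)
    orbitUpTo zero    v = [ v ]
    orbitUpTo (suc k) v = σ^ (suc k) v ∷ orbitUpTo k v

    cycleOf : Fin n → List (Fin n)
    cycleOf v = orbitUpTo (period v) v

    ∈-orbitUpTo⁺ : ∀ {k j v} → j ≤ k → σ^ j v ∈ˡ orbitUpTo k v
    ∈-orbitUpTo⁺ {zero}  z≤n = here refl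
    ∈-orbitUpTo⁺ {suc k} j≤k with m≤n⇒m<n∨m≡n j≤k
    ... | inj₁ j<k  = there (∈-orbitUpTo⁺ (≤-pred j<k))
    ... | inj₂ refl = here refl

    ∈-orbitUpTo⁻ : ∀ {k v w} → w ∈ˡ orbitUpTo k v → ∃[ j ] j ≤ k × σ^ j v ≡ w
    ∈-orbitUpTo⁻ {zero}  (here refl) = 0 , z≤n , refl
    ∈-orbitUpTo⁻ {suc k} (here refl) = suc k , ≤-refl , refl
    ∈-orbitUpTo⁻ {suc k} (there w∈) with j , j≤k , eq ← ∈-orbitUpTo⁻ w∈ = j , m≤n⇒m≤1+n j≤k , eq

    v∈cycleOf[v] : ∀ v → v ∈ˡ cycleOf v
    v∈cycleOf[v] v = ∈-orbitUpTo⁺ {j = 0} z≤n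

    σ-∈-cycleOf : ∀ {v w} → w ∈ˡ cycleOf v → σ w ∈ˡ cycleOf v
    σ-∈-cycleOf {v} w∈ with j , j≤p , refl ← ∈-orbitUpTo⁻ w∈ with m≤n⇒m<n∨m≡n j≤p
    ... | inj₁ j<p  = ∈-orbitUpTo⁺ j<p
    ... | inj₂ refl = subst (_∈ˡ cycleOf v) (sym (σ^-period v)) (v∈cycleOf[v] v)

    σ^-∈-cycleOf : ∀ k {v w} → w ∈ˡ cycleOf v → σ^ k w ∈ˡ cycleOf v
    σ^-∈-cycleOf zero    w∈ = w∈
    σ^-∈-cycleOf (suc k) w∈ = σ-∈-cycleOf (σ^-∈-cycleOf k w∈)

    cycleOf-trans : ∀ {u v w} → u ∈ˡ cycleOf v → w ∈ˡ cycleOf u → w ∈ˡ cycleOf v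
    cycleOf-trans u∈ w∈ with j , _ , refl ← ∈-orbitUpTo⁻ w∈ = σ^-∈-cycleOf j u∈

    cycleOf-sym : ∀ {v w} → w ∈ˡ cycleOf v → v ∈ˡ cycleOf w
    cycleOf-sym {v} {w} w∈ with j , j≤p , refl ← ∈-orbitUpTo⁻ w∈ =
      subst (_∈ˡ cycleOf w) v≡ (σ^-∈-cycleOf (suc (period v) ∸ j) (v∈cycleOf[v] w))
      where
      v≡ : σ^ (suc (period v) ∸ j) (σ^ j v) ≡ v
      v≡ = begin
        σ^ (suc (period v) ∸ j) (σ^ j v) ≡⟨ fold-+ v σ (suc (period v) ∸ j) ⟨
        σ^ (suc (period v) ∸ j + j) v    ≡⟨ cong (λ k → σ^ k v) (m∸n+n≡m (m≤n⇒m≤1+n j≤p)) ⟩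
        σ^ (suc (period v)) v            ≡⟨ σ^-period v ⟩
        v                                ∎
        where open ≡-Reasoning

    unique-orbitUpTo : ∀ {k v} → k ≤ period v → Unique (orbitUpTo k v)
    unique-orbitUpTo {zero}      _   = [] ∷ []
    unique-orbitUpTo {suc k} {v} k<p =
      All.tabulate (λ w∈ eq → let j , j≤k , σ^j≡w = ∈-orbitUpTo⁻ w∈ in
                     σ^-distinct (s≤s j≤k) k<p (trans σ^j≡w (sym eq)))
      ∷ unique-orbitUpTo (≤-trans (n≤1+n k) k<p)

    walk-orbitUpTo : ∀ k {v h} → Arc D v h → Walk D (orbitUpTo k v ++ [ h ])
    walk-orbitUpTo zero          v→h = v→h , tt
    walk-orbitUpTo (suc zero)    v→h = σ-arc _ , v→h , tt
    walk-orbitUpTo (suc (suc k)) v→h = σ-arc _ , walk-orbitUpTo (suc k) v→h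

    isCycle-orbitUpTo : ∀ k {v} → Unique (orbitUpTo k v) → Arc D v (σ^ k v) → IsCycle D (orbitUpTo k v)
    isCycle-orbitUpTo zero    unique v→σ^kv = unique , walk-orbitUpTo zero v→σ^kv
    isCycle-orbitUpTo (suc k) unique v→σ^kv = unique , walk-orbitUpTo (suc k) v→σ^kv

    isCycle-cycleOf : ∀ v → IsCycle D (cycleOf v)
    isCycle-cycleOf v = isCycle-orbitUpTo (period v) (unique-orbitUpTo ≤-refl)
      (subst (λ u → Arc D u (σ^ (period v) v)) (σ^-period v) (σ-arc _))

    -- Every cycle is listed once, as the cycle of its vertex of least index.
    IsRoot : Fin n → Set
    IsRoot v = All (λ w → toℕ v ≤ toℕ w) (cycleOf v)

    isRoot? : Decidable IsRoot
    isRoot? v = All.all? (λ w → toℕ v ≤? toℕ w) (cycleOf v)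

    root-unique : ∀ {u v w} → IsRoot u → IsRoot v → w ∈ˡ cycleOf u → w ∈ˡ cycleOf v → u ≡ v
    root-unique root-u root-v w∈u w∈v = toℕ-injective (≤-antisym
      (All.lookup root-u (cycleOf-trans w∈u (cycleOf-sym w∈v)))
      (All.lookup root-v (cycleOf-trans w∈v (cycleOf-sym w∈u))))

    root : ∀ w → ∃[ r ] IsRoot r × w ∈ˡ cycleOf r
    root w = r , All.tabulate (λ u∈ → All.lookup (f[argmin]≤f[xs] w (cycleOf w)) (cycleOf-trans r∈ u∈)) ,
             cycleOf-sym r∈
      where
      r = argmin toℕ w (cycleOf w)
      r∈ : r ∈ˡ cycleOf w
      r∈ with argmin-sel toℕ w (cycleOf w)
      ... | inj₁ r≡w = subst (_∈ˡ cycleOf w) (sym r≡w) (v∈cycleOf[v] w)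
      ... | inj₂ r∈  = r∈

    cover : CoverableByDisjointCycles D
    cover = map cycleOf roots ,
            All.map⁺ (All.tabulate (λ {v} _ → isCycle-cycleOf v)) ,
            AllPairs.map⁺ (AllPairs-restrict disjoint (all-filter isRoot? (allFin n))
                                             (Unique.filter⁺ isRoot? (allFin⁺ n))) ,
            covered
      where
      roots = filter isRoot? (allFin n)
      disjoint : ∀ {u v} → IsRoot u → IsRoot v → u ≢ v → Disjoint (cycleOf u) (cycleOf v)
      disjoint root-u root-v u≢v w∈u w∈v = u≢v (root-unique root-u root-v w∈u w∈v)
      covered : ∀ w → Any (w ∈ˡ_) (map cycleOf roots)
      covered w with r , root-r , w∈r ← root w =
        Any.map⁺ (Any.map (λ { refl → w∈r }) (∈-filter⁺ isRoot? (∈-allFin r) root-r))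

  module _ {A : Set} where

    next : ∀ {v} (y : A) (r : List A) (f : A) → v ∈ˡ y ∷ r → A
    next y []      f (here _)  = f
    next y (z ∷ r) f (here _)  = z
    next y (z ∷ r) f (there p) = next z r f p

    next-∈ : ∀ {v} y r f (p : v ∈ˡ y ∷ r) → next y r f p ∈ˡ r ++ [ f ]
    next-∈ y []      f (here _)  = here refl
    next-∈ y (z ∷ r) f (here _)  = here refl
    next-∈ y (z ∷ r) f (there p) = there (next-∈ z r f p)

    next-injective : ∀ {v w} y r f (p : v ∈ˡ y ∷ r) (p′ : w ∈ˡ y ∷ r) → Unique (r ++ [ f ]) →
                     next y r f p ≡ next y r f p′ → v ≡ w
    next-injective y r       f (here refl) (here refl) _          _  = refl
    next-injective y (z ∷ r) f (here refl) (there p′)  (z∉ ∷ _)   eq =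
      contradiction eq (All.lookup z∉ (next-∈ z r f p′))
    next-injective y (z ∷ r) f (there p)   (here refl) (z∉ ∷ _)   eq =
      contradiction (sym eq) (All.lookup z∉ (next-∈ z r f p))
    next-injective y (z ∷ r) f (there p)   (there p′)  (_ ∷ uniq) eq = next-injective z r f p p′ uniq eq

  module _ {n : ℕ} (D : Digraph n) where

    next-arc : ∀ {v} y r f (p : v ∈ˡ y ∷ r) → Walk D ((y ∷ r) ++ [ f ]) → Arc D v (next y r f p)
    next-arc y []      f (here refl) (y→f , _) = y→f
    next-arc y (z ∷ r) f (here refl) (y→z , _) = y→z
    next-arc y (z ∷ r) f (there p)   (_ , walk) = next-arc z r f p walk

    cycleSucc : ∀ {c v} → v ∈ˡ c → Fin n
    cycleSucc {x ∷ xs} p = next x xs x p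

    cycleSucc-arc : ∀ {c v} → IsCycle D c → (p : v ∈ˡ c) → Arc D v (cycleSucc p)
    cycleSucc-arc {x ∷ xs} (_ , walk) p = next-arc x xs x p walk

    cycleSucc-∈ : ∀ {c v} (p : v ∈ˡ c) → cycleSucc p ∈ˡ c
    cycleSucc-∈ {x ∷ xs} p with ∈-++⁻ xs (next-∈ x xs x p)
    ... | inj₁ ∈xs        = there ∈xs
    ... | inj₂ (here ≡x) = here ≡x

    cycleSucc-injective : ∀ {c v w} → IsCycle D c → (p : v ∈ˡ c) (p′ : w ∈ˡ c) →
                          cycleSucc p ≡ cycleSucc p′ → v ≡ w
    cycleSucc-injective {x ∷ xs} (x∉xs ∷ uniq , _) p p′ =
      next-injective x xs x p p′
        (Unique.++⁺ uniq ([] ∷ []) λ { (x∈xs , here refl) → All.lookup x∉xs x∈xs refl })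

    coverSucc : ∀ {cs v} → Any (v ∈ˡ_) cs → Fin n
    coverSucc (here p)  = cycleSucc p
    coverSucc (there q) = coverSucc q

    coverSucc-arc : ∀ {cs v} → All (IsCycle D) cs → (q : Any (v ∈ˡ_) cs) → Arc D v (coverSucc q)
    coverSucc-arc (cyc ∷ _)  (here p)  = cycleSucc-arc cyc p
    coverSucc-arc (_ ∷ cycs) (there q) = coverSucc-arc cycs q

    coverSucc-∈ : ∀ {cs v} (q : Any (v ∈ˡ_) cs) → Any (coverSucc q ∈ˡ_) cs
    coverSucc-∈ (here p)  = here (cycleSucc-∈ p)
    coverSucc-∈ (there q) = there (coverSucc-∈ q)

    ∉-All-Disjoint : ∀ {c : List (Fin n)} {cs v} → All (Disjoint c) cs → Any (v ∈ˡ_) cs → ¬ v ∈ˡ c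
    ∉-All-Disjoint (disj ∷ _)  (here v∈)  v∈c = disj v∈c v∈
    ∉-All-Disjoint (_ ∷ disjs) (there q) v∈c = ∉-All-Disjoint disjs q v∈c

    coverSucc-injective : ∀ {cs v w} → All (IsCycle D) cs → AllPairs Disjoint cs →
                          (q : Any (v ∈ˡ_) cs) (q′ : Any (w ∈ˡ_) cs) → coverSucc q ≡ coverSucc q′ → v ≡ w
    coverSucc-injective (cyc ∷ _)  _            (here p)  (here p′)  eq = cycleSucc-injective cyc p p′ eq
    coverSucc-injective _          (disj ∷ _)   (here p)  (there q′) eq =
      ⊥-elim (∉-All-Disjoint disj (coverSucc-∈ q′) (subst (_∈ˡ _) eq (cycleSucc-∈ p)))
    coverSucc-injective _          (disj ∷ _)   (there q) (here p′)  eq =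
      ⊥-elim (∉-All-Disjoint disj (coverSucc-∈ q) (subst (_∈ˡ _) (sym eq) (cycleSucc-∈ p′)))
    coverSucc-injective (_ ∷ cycs) (_ ∷ disjs) (there q) (there q′) eq =
      coverSucc-injective cycs disjs q q′ eq

  cover⇒cycleFactor : ∀ {n} {D : Digraph n} → CoverableByDisjointCycles D → CycleFactor D
  cover⇒cycleFactor {n} {D} (_ , cycles , disjoint , covered) = record
    { σ = τ⁻¹ ; σ-injective = τ⁻¹-injective ; σ-arc = λ v → subst (Arc D (τ⁻¹ v)) (τ∘τ⁻¹ v) (τ-arc (τ⁻¹ v)) }
    where
    τ : Fin n → Fin n
    τ v = coverSucc D (covered v)
    τ-arc : ∀ v → Arc D v (τ v)
    τ-arc v = coverSucc-arc D cycles (covered v)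
    open InverseOfInjective {f = τ} (coverSucc-injective D cycles disjoint (covered _) (covered _))
      renaming (f⁻¹ to τ⁻¹; f∘f⁻¹ to τ∘τ⁻¹; f⁻¹-injective to τ⁻¹-injective)

module _ {q : ℕ} where

  isBig : Fin (3 + q) → Bool
  isBig zero          = false
  isBig (suc zero)    = false
  isBig (suc (suc _)) = true

  flip01 : Bool → Fin (3 + q) → Fin (3 + q)
  flip01 false a             = a
  flip01 true  zero          = suc zero
  flip01 true  (suc zero)    = zero
  flip01 true  (suc (suc a)) = suc (suc a)

  flip01-involutive : ∀ b a → flip01 b (flip01 b a) ≡ a
  flip01-involutive false a             = refl
  flip01-involutive true  zero          = refl
  flip01-involutive true  (suc zero)    = refl
  flip01-involutive true  (suc (suc a)) = refl

  flip01-injective : ∀ b {a a′} → flip01 b a ≡ flip01 b a′ → a ≡ a′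
  flip01-injective b {a} {a′} eq =
    trans (sym (flip01-involutive b a)) (trans (cong (flip01 b) eq) (flip01-involutive b a′))

  isBig-flip01 : ∀ b a → isBig (flip01 b a) ≡ isBig a
  isBig-flip01 false a             = refl
  isBig-flip01 true  zero          = refl
  isBig-flip01 true  (suc zero)    = refl
  isBig-flip01 true  (suc (suc a)) = refl

module Construction {n q : ℕ} {D : Digraph n} (factor : CycleFactor D) where
  open CycleFactor factor
  open InverseOfInjective σ-injective using () renaming (f⁻¹ to τ; f∘f⁻¹ to σ∘τ; f⁻¹∘f to τ∘σ)

  Gate : Fin n → Config n (3 + q) → Set
  Gate v x = ∀ u → Arc D u v → u ≢ σ v → isBig (lookup x u) ≡ true

  gate? : ∀ v x → Dec (Gate v x)
  gate? v x = all? λ u → (D u v ≟ᵇ true) →-dec ¬? (u ≟ᶠ σ v) →-dec isBig (lookup x u) ≟ᵇ true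

  gate-cong : ∀ v x y → (∀ u → Arc D u v → u ≢ σ v → isBig (lookup x u) ≡ isBig (lookup y u)) →
              does (gate? v x) ≡ does (gate? v y)
  gate-cong v x y agree = does-⇔
    (mk⇔ (λ open-x u u→v u≢σv → trans (sym (agree u u→v u≢σv)) (open-x u u→v u≢σv))
         (λ open-y u u→v u≢σv → trans (agree u u→v u≢σv) (open-y u u→v u≢σv)))
    (gate? v x) (gate? v y)

  f : Config n (3 + q) → Config n (3 + q)
  f x = tabulate λ v → flip01 (does (gate? v x)) (lookup x (σ v))

  lookup-f : ∀ x v → lookup (f x) v ≡ flip01 (does (gate? v x)) (lookup x (σ v))
  lookup-f x = lookup∘tabulate _

  isBig-f : ∀ x v → isBig (lookup (f x) v) ≡ isBig (lookup x (σ v))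
  isBig-f x v = trans (cong isBig (lookup-f x v)) (isBig-flip01 _ _)

  _∘τ : Config n (3 + q) → Config n (3 + q)
  y ∘τ = tabulate λ w → lookup y (τ w)

  -- f moves the big/small pattern along σ, so the pattern of x, hence its gates, can be read off f x.
  isBig-f∘τ : ∀ x w → isBig (lookup (f x ∘τ) w) ≡ isBig (lookup x w)
  isBig-f∘τ x w = begin
    isBig (lookup (f x ∘τ) w)   ≡⟨ cong isBig (lookup∘tabulate _ w) ⟩
    isBig (lookup (f x) (τ w))  ≡⟨ isBig-f x (τ w) ⟩
    isBig (lookup x (σ (τ w)))  ≡⟨ cong (isBig ∘ lookup x) (σ∘τ w) ⟩
    isBig (lookup x w)          ∎
    where open ≡-Reasoning

  f⁻¹ : Config n (3 + q) → Config n (3 + q)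
  f⁻¹ y = tabulate λ u → flip01 (does (gate? (τ u) (y ∘τ))) (lookup y (τ u))

  f⁻¹∘f : ∀ x → f⁻¹ (f x) ≡ x
  f⁻¹∘f x = trans (tabulate-cong λ u → begin
      flip01 (does (gate? (τ u) (f x ∘τ))) (lookup (f x) (τ u))
        ≡⟨ cong₂ flip01 (gate-cong (τ u) (f x ∘τ) x λ w _ _ → isBig-f∘τ x w) (lookup-f x (τ u)) ⟩
      flip01 (does (gate? (τ u) x)) (flip01 (does (gate? (τ u) x)) (lookup x (σ (τ u))))
        ≡⟨ flip01-involutive (does (gate? (τ u) x)) (lookup x (σ (τ u))) ⟩
      lookup x (σ (τ u))
        ≡⟨ cong (lookup x) (σ∘τ u) ⟩
      lookup x u ∎)
    (tabulate∘lookup x)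
    where open ≡-Reasoning

  f∘f⁻¹ : ∀ y → f (f⁻¹ y) ≡ y
  f∘f⁻¹ y = trans (tabulate-cong λ v → begin
      flip01 (does (gate? v (f⁻¹ y))) (lookup (f⁻¹ y) (σ v))
        ≡⟨ cong₂ flip01 (gate-cong v (f⁻¹ y) (y ∘τ) λ w _ _ → isBig-f⁻¹ w) (lookup∘tabulate _ (σ v)) ⟩
      flip01 (does (gate? v (y ∘τ))) (flip01 (does (gate? (τ (σ v)) (y ∘τ))) (lookup y (τ (σ v))))
        ≡⟨ cong (λ u → flip01 (does (gate? v (y ∘τ))) (flip01 (does (gate? u (y ∘τ))) (lookup y u))) (τ∘σ v) ⟩
      flip01 (does (gate? v (y ∘τ))) (flip01 (does (gate? v (y ∘τ))) (lookup y v))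
        ≡⟨ flip01-involutive (does (gate? v (y ∘τ))) (lookup y v) ⟩
      lookup y v ∎)
    (tabulate∘lookup y)
    where
    open ≡-Reasoning
    isBig-f⁻¹ : ∀ w → isBig (lookup (f⁻¹ y) w) ≡ isBig (lookup (y ∘τ) w)
    isBig-f⁻¹ w = trans (cong isBig (lookup∘tabulate _ w))
                        (trans (isBig-flip01 _ _) (sym (cong isBig (lookup∘tabulate _ w))))

  f-bijective : IsPermutation f
  f-bijective = inverseᵇ⇒bijective
    (strictlyInverseˡ⇒inverseˡ {f⁻¹ = f⁻¹} f f∘f⁻¹ , strictlyInverseʳ⇒inverseʳ {f⁻¹ = f⁻¹} f f⁻¹∘f)

  f-local : ∀ v {x y} → (∀ u → Arc D u v → lookup x u ≡ lookup y u) → lookup (f x) v ≡ lookup (f y) v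
  f-local v {x} {y} agree = begin
    lookup (f x) v                                   ≡⟨ lookup-f x v ⟩
    flip01 (does (gate? v x)) (lookup x (σ v))
      ≡⟨ cong₂ flip01 (gate-cong v x y λ u u→v _ → cong isBig (agree u u→v)) (agree (σ v) (σ-arc v)) ⟩
    flip01 (does (gate? v y)) (lookup y (σ v))       ≡⟨ lookup-f y v ⟨
    lookup (f y) v                                   ∎
    where open ≡-Reasoning

  dependsOn⇒arc : ∀ u v → DependsOn f u v → Arc D u v
  dependsOn⇒arc u v (x , y , agree , differ) with D u v ≟ᵇ true
  ... | yes u→v = u→v
  ... | no  u↛v = contradiction (f-local v {x} {y} λ w w→v → agree w λ { refl → u↛v w→v }) differ

  two : Fin (3 + q)
  two = suc (suc zero)

  spike : Fin n → Fin (3 + q) → Config n (3 + q)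
  spike v a = replicate n two [ σ v ]≔ a

  lookup-spike-σ : ∀ v a → lookup (spike v a) (σ v) ≡ a
  lookup-spike-σ v a = lookup∘update (σ v) (replicate n two) a

  lookup-spike : ∀ v a {u} → u ≢ σ v → lookup (spike v a) u ≡ two
  lookup-spike v a {u} u≢σv = trans (lookup∘update′ u≢σv (replicate n two) a) (lookup-replicate u two)

  dependsOn-σ : ∀ v → DependsOn f (σ v) v
  dependsOn-σ v = spike v zero , spike v (suc zero) , agree , λ eq → 0≢1 (flip01-injective g (begin
      flip01 g zero
        ≡⟨ cong (flip01 g) (lookup-spike-σ v zero) ⟨
      flip01 g (lookup (spike v zero) (σ v))
        ≡⟨ trans (sym (lookup-f (spike v zero) v)) (trans eq (lookup-f (spike v (suc zero)) v)) ⟩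
      flip01 (does (gate? v (spike v (suc zero)))) (lookup (spike v (suc zero)) (σ v))
        ≡⟨ cong₂ flip01
             (gate-cong v (spike v (suc zero)) (spike v zero) λ u _ u≢σv → cong isBig (sym (agree u u≢σv)))
             (lookup-spike-σ v (suc zero)) ⟩
      flip01 g (suc zero) ∎))
    where
    open ≡-Reasoning
    g : Bool
    g = does (gate? v (spike v zero))
    agree : ∀ w → w ≢ σ v → lookup (spike v zero) w ≡ lookup (spike v (suc zero)) w
    agree w w≢σv = trans (lookup-spike v zero w≢σv) (sym (lookup-spike v (suc zero) w≢σv))
    0≢1 : zero ≢ suc zero
    0≢1 ()

  dependsOn-other : ∀ {u v} → Arc D u v → u ≢ σ v → DependsOn f u v
  dependsOn-other {u} {v} u→v u≢σv = x , y , agree , λ eq → 1≢0 (begin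
    suc zero                                   ≡⟨ cong₂ flip01 gate-x (lookup-spike-σ v zero) ⟨
    flip01 (does (gate? v x)) (lookup x (σ v)) ≡⟨ lookup-f x v ⟨
    lookup (f x) v                             ≡⟨ eq ⟩
    lookup (f y) v                             ≡⟨ lookup-f y v ⟩
    flip01 (does (gate? v y)) (lookup y (σ v))
      ≡⟨ cong₂ flip01 gate-y (trans (lookup∘update′ (u≢σv ∘ sym) x zero) (lookup-spike-σ v zero)) ⟩
    zero                                       ∎)
    where
    open ≡-Reasoning
    x y : Config n (3 + q)
    x = spike v zero
    y = x [ u ]≔ zero
    agree : ∀ w → w ≢ u → lookup x w ≡ lookup y w
    agree w w≢u = sym (lookup∘update′ w≢u x zero)
    gate-x : does (gate? v x) ≡ true
    gate-x = dec-true (gate? v x) λ w _ w≢σv → cong isBig (lookup-spike v zero w≢σv)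
    gate-y : does (gate? v y) ≡ false
    gate-y = dec-false (gate? v y) λ open-y → false≢true
      (trans (cong isBig (sym (lookup∘update u x zero))) (open-y u u→v u≢σv))
      where false≢true : false ≢ true
            false≢true ()
    1≢0 : suc zero ≢ zero
    1≢0 ()

  f∈F : InF D (3 + q) f
  f∈F u v = mk⇔ arc⇒dependsOn (dependsOn⇒arc u v)
    where
    arc⇒dependsOn : Arc D u v → DependsOn f u v
    arc⇒dependsOn u→v with u ≟ᶠ σ v
    ... | yes refl  = dependsOn-σ v
    ... | no  u≢σv = dependsOn-other u→v u≢σv

corollary4 : (n : ℕ) (D : Digraph n) (q : ℕ) → q ≥ 3 →
    (Σ (Config n q → Config n q) (λ f → InF D q f × IsPermutation f))
      ⇔ CoverableByDisjointCycles D
corollary4 n D (suc (suc (suc q))) (s≤s (s≤s (s≤s _))) = mk⇔ necessary sufficient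
  where
  necessary : Σ (Config n (3 + q) → Config n (3 + q)) (λ f → InF D (3 + q) f × IsPermutation f) →
              CoverableByDisjointCycles D
  necessary (f , f∈F , f-bijective) =
    Cycles.Orbits.cover (permutation⇒cycleFactor f∈F f-bijective (s≤s (s≤s z≤n)))

  sufficient : CoverableByDisjointCycles D →
               Σ (Config n (3 + q) → Config n (3 + q)) (λ f → InF D (3 + q) f × IsPermutation f)
  sufficient cover = f , f∈F , f-bijective
    where open Construction {q = q} (Cycles.cover⇒cycleFactor cover)
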